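{- Let $n\ge3$. Then $W^1_{n-1}=W^1_{n-2}\cup W^1_{n-2}\,w_{n-1}$, where $W^1_{n-2}\subset S_{n-1}$ is viewed inside $S_n$ as permutations of $\{1,\dots,n-1\}$ fixing $n$, and $w_{n-1}\in S_n$ is the longest element, $w_{n-1}(i)=n+1-i$.
   Context: For $k\ge1$, type $A_k$: $\alpha_{i,j}=e_i-e_j$, positive roots $\alpha_{i,j}$ ($1\le i<j\le k+1$), simple roots $\alpha_i=\alpha_{i,i+1}$; $S_{k+1}$ acts by $e_a\mapsto e_{w(a)}$, and $|\beta|$ is whichever of $\pm\beta$ is positive. $C(S)=\sum_{\alpha\in S}\mathbb{R}_{\ge0}\alpha$. $\mathfrak{a}^1_k=C(\alpha_{1,2},\alpha_{1,3},\dots,\alpha_{1,k+1})$, and $W^1_k=\{w\in S_{k+1}:(\mathfrak{a}^1_k)^\circ\subset C(|w\alpha_1|,\dots,|w\alpha_k|)\}$, where $^\circ$ denotes interior in $\{x\in\mathbb{R}^{k+1}:\sum x_i=0\}$.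
   Formalization: In defining $W^1_k$, points have rational coordinates, the coefficients of the cones $C(S)$ are rational, and the interior is taken among rational points, rather than over the reals. -}

module Defs where

open import Data.Nat using (ℕ; zero; suc)
open import Data.Fin using (Fin; zero; suc; toℕ; inject₁; fromℕ; opposite)
open import Data.Fin.Permutation using (Permutation′; _⟨$⟩ʳ_)
open import Data.Maybe using (Maybe; just; nothing; maybe)
import Data.Maybe as Maybe
open import Data.Rational using (ℚ; 0ℚ; 1ℚ; _+_; _-_; _*_; _≤_; _<_; ∣_∣)
open import Data.Product using (Σ; ∃; _×_)
open import Relation.Binary.PropositionalEquality using (_≡_)
open import Relation.Nullary using (does)
import Data.Nat as ℕ
open import Data.Bool using (true; false)

-- Points of ℝ^m, realised with rational coordinates.
Pt : ℕ → Set
Pt m = Fin m → ℚ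

sumFin : ∀ {r} → (Fin r → ℚ) → ℚ
sumFin {zero}  f = 0ℚ
sumFin {suc r} f = f zero + sumFin (λ j → f (suc j))

InV : ∀ {m} → Pt m → Set
InV x = sumFin x ≡ 0ℚ

e : ∀ {m} → Fin m → Pt m
e a i with does (toℕ a ℕ.≟ toℕ i)
... | true  = 1ℚ
... | false = 0ℚ

α : ∀ {m} → Fin m → Fin m → Pt m
α a b i = e a i - e b i

absRoot : ∀ {m} → Fin m → Fin m → Pt m
absRoot a b with does (toℕ a ℕ.<? toℕ b)
... | true  = α a b
... | false = α b a

InCone : ∀ {m r} → (Fin r → Pt m) → Pt m → Set
InCone {m} {r} v x =
  Σ (Fin r → ℚ) λ c → (∀ j → 0ℚ ≤ c j) × (∀ i → x i ≡ sumFin (λ j → c j * v j i))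

-- Interior relative to the hyperplane V (sup-norm balls).
InInterior : ∀ {m} → (Pt m → Set) → Pt m → Set
InInterior {m} A x =
  InV x × Σ ℚ λ ε → (0ℚ < ε) ×
    (∀ (y : Pt m) → InV y → (∀ i → ∣ y i - x i ∣ < ε) → A y)

a1 : ∀ k → Fin k → Pt (suc k)
a1 k j = α zero (suc j)

-- |w α_i| for i = 1..k, with w α_{i,i+1} = e_{w i} - e_{w (i+1)}
wSimple : ∀ k → (Fin (suc k) → Fin (suc k)) → Fin k → Pt (suc k)
wSimple k w i = absRoot (w (inject₁ i)) (w (suc i))

W1 : ∀ k → Permutation′ (suc k) → Set
W1 k w = ∀ x → InInterior (InCone (a1 k)) x → InCone (wSimple k (w ⟨$⟩ʳ_)) x

lowerLast : ∀ m → Fin (suc m) → Maybe (Fin m)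
lowerLast zero    zero    = nothing
lowerLast (suc m) zero    = just zero
lowerLast (suc m) (suc i) = Maybe.map suc (lowerLast m i)

ext : ∀ {m} → Permutation′ m → Fin (suc m) → Fin (suc m)
ext {m} u i = maybe (λ j → inject₁ (u ⟨$⟩ʳ j)) (fromℕ m) (lowerLast m i)

-- longest element w_{n-1}(i) = n+1-i of S_n, on Fin n (0-based: i ↦ n-1-i)
w₀ : ∀ {n} → Fin n → Fin n
w₀ = opposite

-- A permutation w lies in W¹ exactly when the sequence w(1), …, w(k+1) is valley-shaped:
-- no ascent is ever followed by a descent.  Writing a point x as Σ cᵢ |wαᵢ| forces
-- cᵢ · sign(wαᵢ) to be the i-th prefix sum of x∘w.  For x in the interior of 𝔞¹ every
-- coordinate except x₁ is negative while Σ x = 0, so these prefix sums are negative before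
-- the position w⁻¹(1) and positive from it on; hence all cᵢ ≥ 0 iff w descends exactly
-- before that position.  A valley-shaped permutation of {1, …, n} takes the value n at one
-- of its two ends: if w(n) = n, w extends a valley-shaped permutation of {1, …, n−1};
-- if w(1) = n, the same holds for w w_{n−1}.

module Submission where

open import Defs
open import Algebra.Bundles using (Ring)
import Algebra.Properties.Semiring.Sum as SemiringSum
open import Data.Bool using (true; false)
open import Data.Empty using (⊥-elim)
open import Data.Fin as Fin using (Fin; zero; suc; toℕ; inject₁; fromℕ; opposite; punchIn)
open import Data.Fin.Permutation
  using (Permutation′; _⟨$⟩ʳ_; _⟨$⟩ˡ_; inverseˡ; inverseʳ; remove; punchIn-permute; reverse; _∘ₚ_)
open import Data.Fin.Properties as Finₚ
  using (toℕ-injective; toℕ-inject₁; toℕ-fromℕ; opposite-prop; opposite-involutive)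
open import Data.Fin.Relation.Unary.Top using (view; ‵fromℕ; ‵inject₁)
open import Data.Maybe as Maybe using (just; nothing)
open import Data.Nat as ℕ using (ℕ; suc; z≤n; s≤s)
import Data.Nat.Properties as ℕₚ
open import Data.Product using (Σ; _×_; _,_; proj₁; proj₂; map₂)
open import Data.Rational using (ℚ; 0ℚ; 1ℚ; _+_; _-_; _*_; -_; _≤_; _<_; ∣_∣)
import Data.Rational.Properties as ℚ
open import Data.Rational.Solver using (module +-*-Solver)
open import Data.Sum using (_⊎_; inj₁; inj₂)
open import Function.Base using (_∘_; case_of_)
open import Function.Bundles using (Injection; _⇔_; mk⇔; Equivalence)
open import Function.Properties.Inverse using (↔⇒↣)
open import Relation.Binary.Definitions using (tri<; tri≈; tri>)
open import Relation.Binary.PropositionalEquality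
open import Relation.Nullary using (¬_; yes; no; does)
open import Relation.Nullary.Decidable using (dec-true; dec-false)

open +-*-Solver

module Σℚ = SemiringSum (Ring.semiring ℚ.+-*-ring)

sumFin≡sum : ∀ {r} (f : Fin r → ℚ) → sumFin f ≡ Σℚ.sum f
sumFin≡sum {ℕ.zero} f = refl
sumFin≡sum {suc r}  f = cong (f zero +_) (sumFin≡sum (f ∘ suc))

sumFin-cong : ∀ {r} {f g : Fin r → ℚ} → (∀ i → f i ≡ g i) → sumFin f ≡ sumFin g
sumFin-cong {f = f} {g} f≗g = begin
  sumFin f  ≡⟨ sumFin≡sum f ⟩
  Σℚ.sum f  ≡⟨ Σℚ.sum-cong-≗ f≗g ⟩
  Σℚ.sum g  ≡⟨ sumFin≡sum g ⟨
  sumFin g  ∎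
  where open ≡-Reasoning

sumFin-+ : ∀ {r} (f g : Fin r → ℚ) → sumFin (λ i → f i + g i) ≡ sumFin f + sumFin g
sumFin-+ f g = begin
  sumFin (λ i → f i + g i)  ≡⟨ sumFin≡sum (λ i → f i + g i) ⟩
  Σℚ.sum (λ i → f i + g i)  ≡⟨ Σℚ.∑-distrib-+ f g ⟩
  Σℚ.sum f + Σℚ.sum g       ≡⟨ cong₂ _+_ (sumFin≡sum f) (sumFin≡sum g) ⟨
  sumFin f + sumFin g       ∎
  where open ≡-Reasoning

*-distribˡ-sumFin : ∀ {r} c (f : Fin r → ℚ) → c * sumFin f ≡ sumFin (λ i → c * f i)
*-distribˡ-sumFin c f = begin
  c * sumFin f              ≡⟨ cong (c *_) (sumFin≡sum f) ⟩
  c * Σℚ.sum f              ≡⟨ Σℚ.*-distribˡ-sum c f ⟩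
  Σℚ.sum (λ i → c * f i)    ≡⟨ sumFin≡sum (λ i → c * f i) ⟨
  sumFin (λ i → c * f i)    ∎
  where open ≡-Reasoning

sumFin-permute : ∀ {r} (f : Fin r → ℚ) (π : Permutation′ r) → sumFin f ≡ sumFin (λ i → f (π ⟨$⟩ʳ i))
sumFin-permute f π = begin
  sumFin f                    ≡⟨ sumFin≡sum f ⟩
  Σℚ.sum f                    ≡⟨ Σℚ.sum-permute f π ⟩
  Σℚ.sum (λ i → f (π ⟨$⟩ʳ i)) ≡⟨ sumFin≡sum (λ i → f (π ⟨$⟩ʳ i)) ⟨
  sumFin (λ i → f (π ⟨$⟩ʳ i)) ∎
  where open ≡-Reasoning

sumFin-zero : ∀ r → sumFin {r} (λ _ → 0ℚ) ≡ 0ℚ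
sumFin-zero r = trans (sumFin≡sum {r} (λ _ → 0ℚ)) (Σℚ.sum-replicate-zero r)

permutation-injective : ∀ {m} (π : Permutation′ m) {a b} → π ⟨$⟩ʳ a ≡ π ⟨$⟩ʳ b → a ≡ b
permutation-injective π = Injection.injective (↔⇒↣ π)

e-diagonal : ∀ {m} (a : Fin m) → e a a ≡ 1ℚ
e-diagonal a rewrite dec-true (toℕ a ℕ.≟ toℕ a) refl = refl

e-offDiagonal : ∀ {m} {a b : Fin m} → a ≢ b → e a b ≡ 0ℚ
e-offDiagonal {a = a} {b} a≢b rewrite dec-false (toℕ a ℕ.≟ toℕ b) (a≢b ∘ toℕ-injective) = refl

e-permute : ∀ {m} (π : Permutation′ m) a b → e (π ⟨$⟩ʳ a) (π ⟨$⟩ʳ b) ≡ e a b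
e-permute π a b with a Fin.≟ b
... | yes refl = trans (e-diagonal (π ⟨$⟩ʳ a)) (sym (e-diagonal a))
... | no a≢b   = trans (e-offDiagonal (a≢b ∘ permutation-injective π)) (sym (e-offDiagonal a≢b))

sumFin-e : ∀ {r} (a : Fin r) → sumFin (e a) ≡ 1ℚ
sumFin-e {suc r} zero    = trans (cong (1ℚ +_) (sumFin-zero r)) (ℚ.+-identityʳ 1ℚ)
sumFin-e {suc r} (suc a) = trans (cong (0ℚ +_) (sumFin-e a)) (ℚ.+-identityˡ 1ℚ)

sumFin-*e : ∀ {r} (f : Fin r → ℚ) a → sumFin (λ l → f l * e l a) ≡ f a
sumFin-*e {suc r} f zero = begin
  f zero * 1ℚ + sumFin (λ l → f (suc l) * 0ℚ)  ≡⟨ cong₂ _+_ (ℚ.*-identityʳ (f zero)) (sumFin-cong (ℚ.*-zeroʳ ∘ f ∘ suc)) ⟩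
  f zero + sumFin {r} (λ _ → 0ℚ)               ≡⟨ cong (f zero +_) (sumFin-zero r) ⟩
  f zero + 0ℚ                                  ≡⟨ ℚ.+-identityʳ (f zero) ⟩
  f zero                                       ∎
  where open ≡-Reasoning
sumFin-*e {suc r} f (suc a) = begin
  f zero * 0ℚ + sumFin (λ l → f (suc l) * e l a)  ≡⟨ cong₂ _+_ (ℚ.*-zeroʳ (f zero)) (sumFin-*e (f ∘ suc) a) ⟩
  0ℚ + f (suc a)                                  ≡⟨ ℚ.+-identityˡ (f (suc a)) ⟩
  f (suc a)                                       ∎
  where open ≡-Reasoning

prefixSum : ∀ {k} → (Fin (suc k) → ℚ) → Fin k → ℚ
prefixSum y zero    = y zero
prefixSum y (suc i) = y zero + prefixSum (y ∘ suc) i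

suffixSum : ∀ {k} → (Fin (suc k) → ℚ) → Fin k → ℚ
suffixSum y zero    = sumFin (y ∘ suc)
suffixSum y (suc i) = suffixSum (y ∘ suc) i

sumFin≡prefixSum+suffixSum : ∀ {k} (y : Fin (suc k) → ℚ) i → sumFin y ≡ prefixSum y i + suffixSum y i
sumFin≡prefixSum+suffixSum y zero    = refl
sumFin≡prefixSum+suffixSum y (suc i) = begin
  y zero + sumFin (y ∘ suc)                                  ≡⟨ cong (y zero +_) (sumFin≡prefixSum+suffixSum (y ∘ suc) i) ⟩
  y zero + (prefixSum (y ∘ suc) i + suffixSum (y ∘ suc) i)  ≡⟨ ℚ.+-assoc (y zero) _ _ ⟨
  y zero + prefixSum (y ∘ suc) i + suffixSum (y ∘ suc) i    ∎
  where open ≡-Reasoning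

sumFin-negative : ∀ {r} (f : Fin (suc r) → ℚ) → (∀ j → f j < 0ℚ) → sumFin f < 0ℚ
sumFin-negative {ℕ.zero} f f<0 = subst (_< 0ℚ) (sym (ℚ.+-identityʳ (f zero))) (f<0 zero)
sumFin-negative {suc r}  f f<0 = ℚ.+-mono-< (f<0 zero) (sumFin-negative (f ∘ suc) (f<0 ∘ suc))

prefixSum-negative : ∀ {k} (y : Fin (suc k) → ℚ) i → (∀ l → l Fin.≤ i → y l < 0ℚ) → prefixSum y i < 0ℚ
prefixSum-negative y zero    y<0 = y<0 zero z≤n
prefixSum-negative y (suc i) y<0 =
  ℚ.+-mono-< (y<0 zero z≤n) (prefixSum-negative (y ∘ suc) i (λ l → y<0 (suc l) ∘ s≤s))

suffixSum-negative : ∀ {k} (y : Fin (suc k) → ℚ) i → (∀ l → i Fin.< l → y l < 0ℚ) → suffixSum y i < 0ℚ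
suffixSum-negative y zero    y<0 = sumFin-negative (y ∘ suc) (λ l → y<0 (suc l) (s≤s z≤n))
suffixSum-negative y (suc i) y<0 = suffixSum-negative (y ∘ suc) i (λ l → y<0 (suc l) ∘ s≤s)

module _ {k} {y : Fin (suc k) → ℚ} {p : Fin (suc k)}
         (∑y≡0 : sumFin y ≡ 0ℚ) (y<0 : ∀ l → l ≢ p → y l < 0ℚ) where

  prefixSum-negative-before : ∀ i → i Fin.< p → prefixSum y i < 0ℚ
  prefixSum-negative-before i i<p = prefixSum-negative y i λ where
    l l≤i → y<0 l λ { refl → ℕₚ.<-irrefl refl (ℕₚ.≤-<-trans l≤i i<p) }

  prefixSum-positive-from : ∀ i → p Fin.≤ i → 0ℚ < prefixSum y i
  prefixSum-positive-from i p≤i = subst (0ℚ <_) (sym prefixSum≡-suffixSum) (ℚ.neg-antimono-< suffixSum<0)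
    where
    suffixSum<0 : suffixSum y i < 0ℚ
    suffixSum<0 = suffixSum-negative y i λ where
      l i<l → y<0 l λ { refl → ℕₚ.<-irrefl refl (ℕₚ.<-≤-trans i<l p≤i) }
    prefixSum≡-suffixSum : prefixSum y i ≡ - suffixSum y i
    prefixSum≡-suffixSum = begin
      prefixSum y i                                    ≡⟨ solve 2 (λ a b → a := (a :+ b) :- b) refl (prefixSum y i) (suffixSum y i) ⟩
      (prefixSum y i + suffixSum y i) - suffixSum y i  ≡⟨ cong (_- suffixSum y i) (trans (sym (sumFin≡prefixSum+suffixSum y i)) ∑y≡0) ⟩
      0ℚ - suffixSum y i                               ≡⟨ ℚ.+-identityˡ (- suffixSum y i) ⟩
      - suffixSum y i                                  ∎
      where open ≡-Reasoning

prefixSum-cong : ∀ {k} {y z : Fin (suc k) → ℚ} → (∀ j → y j ≡ z j) → ∀ i → prefixSum y i ≡ prefixSum z i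
prefixSum-cong y≗z zero    = y≗z zero
prefixSum-cong y≗z (suc i) = cong₂ _+_ (y≗z zero) (prefixSum-cong (y≗z ∘ suc) i)

prefixSum-subtract-e₀ : ∀ {k} (z : Fin (suc k) → ℚ) c i → prefixSum (λ j → z j - c * e zero j) i ≡ prefixSum z i - c
prefixSum-subtract-e₀ z c zero    = cong (λ t → z zero - t) (ℚ.*-identityʳ c)
prefixSum-subtract-e₀ z c (suc i) = begin
  (z zero - c * 1ℚ) + prefixSum (λ j → z (suc j) - c * 0ℚ) i
    ≡⟨ cong ((z zero - c * 1ℚ) +_) (prefixSum-cong (λ j → solve 2 (λ a c → a :- c :* con 0ℚ := a) refl (z (suc j)) c) i) ⟩
  (z zero - c * 1ℚ) + prefixSum (z ∘ suc) i
    ≡⟨ solve 3 (λ a c s → (a :- c :* con 1ℚ) :+ s := (a :+ s) :- c) refl (z zero) c (prefixSum (z ∘ suc) i) ⟩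
  (z zero + prefixSum (z ∘ suc) i) - c
    ∎
  where open ≡-Reasoning

simpleRootCombination : ∀ {k} → (Fin k → ℚ) → Pt (suc k)
simpleRootCombination r j = sumFin (λ i → r i * α (inject₁ i) (suc i) j)

simpleRootCombination-zero : ∀ {k} (r : Fin (suc k) → ℚ) → simpleRootCombination r zero ≡ r zero
simpleRootCombination-zero {k} r = begin
  r zero * (1ℚ - 0ℚ) + sumFin (λ i → r (suc i) * (0ℚ - 0ℚ))
    ≡⟨ cong₂ _+_ (solve 1 (λ a → a :* (con 1ℚ :- con 0ℚ) := a) refl (r zero))
                 (sumFin-cong (λ i → solve 1 (λ a → a :* (con 0ℚ :- con 0ℚ) := con 0ℚ) refl (r (suc i)))) ⟩
  r zero + sumFin {k} (λ _ → 0ℚ)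
    ≡⟨ cong (r zero +_) (sumFin-zero k) ⟩
  r zero + 0ℚ
    ≡⟨ ℚ.+-identityʳ (r zero) ⟩
  r zero
    ∎
  where open ≡-Reasoning

simpleRootCombination-+ : ∀ {k} (a b : Fin k → ℚ) j →
  simpleRootCombination (λ i → a i + b i) j ≡ simpleRootCombination a j + simpleRootCombination b j
simpleRootCombination-+ a b j = trans
  (sumFin-cong λ i → solve 3 (λ a b x → (a :+ b) :* x := a :* x :+ b :* x) refl (a i) (b i) (α (inject₁ i) (suc i) j))
  (sumFin-+ (λ i → a i * α (inject₁ i) (suc i) j) (λ i → b i * α (inject₁ i) (suc i) j))

simpleRootCombination-const : ∀ {k} c j → simpleRootCombination {k} (λ _ → c) j ≡ c * α zero (fromℕ k) j
simpleRootCombination-const {ℕ.zero} c zero    = solve 1 (λ c → con 0ℚ := c :* (con 1ℚ :- con 1ℚ)) refl c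
simpleRootCombination-const {suc k}  c zero    =
  trans (simpleRootCombination-zero {k} (λ _ → c)) (solve 1 (λ c → c := c :* (con 1ℚ :- con 0ℚ)) refl c)
simpleRootCombination-const {suc k}  c (suc j) = trans
  (cong (c * (0ℚ - e zero j) +_) (simpleRootCombination-const c j))
  (solve 3 (λ c a b → c :* (con 0ℚ :- a) :+ c :* (a :- b) := c :* (con 0ℚ :- b)) refl c (e zero j) (e (fromℕ k) j))

prefixSum-simpleRootCombination : ∀ {k} (r : Fin k → ℚ) i → prefixSum (simpleRootCombination r) i ≡ r i
prefixSum-simpleRootCombination r zero    = simpleRootCombination-zero r
prefixSum-simpleRootCombination r (suc i) = begin
  simpleRootCombination r zero + prefixSum (λ j → r zero * (0ℚ - e zero j) + simpleRootCombination (r ∘ suc) j) i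
    ≡⟨ cong₂ _+_ (simpleRootCombination-zero r) (prefixSum-cong (λ j →
         solve 3 (λ c x t → c :* (con 0ℚ :- x) :+ t := t :- c :* x) refl (r zero) (e zero j) (simpleRootCombination (r ∘ suc) j)) i) ⟩
  r zero + prefixSum (λ j → simpleRootCombination (r ∘ suc) j - r zero * e zero j) i
    ≡⟨ cong (r zero +_) (prefixSum-subtract-e₀ (simpleRootCombination (r ∘ suc)) (r zero) i) ⟩
  r zero + (prefixSum (simpleRootCombination (r ∘ suc)) i - r zero)
    ≡⟨ cong (λ t → r zero + (t - r zero)) (prefixSum-simpleRootCombination (r ∘ suc) i) ⟩
  r zero + (r (suc i) - r zero)
    ≡⟨ solve 2 (λ a b → a :+ (b :- a) := b) refl (r zero) (r (suc i)) ⟩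
  r (suc i)
    ∎
  where open ≡-Reasoning

simpleRootCombination-prefixSum : ∀ {k} (y : Fin (suc k) → ℚ) j →
  simpleRootCombination (prefixSum y) j ≡ y j - e (fromℕ k) j * sumFin y
simpleRootCombination-prefixSum {ℕ.zero} y zero = solve 1 (λ a → con 0ℚ := a :- con 1ℚ :* (a :+ con 0ℚ)) refl (y zero)
simpleRootCombination-prefixSum {suc k}  y zero =
  trans (simpleRootCombination-zero (prefixSum y)) (solve 2 (λ a s → a := a :- con 0ℚ :* s) refl (y zero) (sumFin y))
simpleRootCombination-prefixSum {suc k}  y (suc j) = begin
  y₀ * (0ℚ - e zero j) + simpleRootCombination (λ i → y₀ + prefixSum y′ i) j
    ≡⟨ cong (y₀ * (0ℚ - e zero j) +_) (simpleRootCombination-+ (λ _ → y₀) (prefixSum y′) j) ⟩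
  y₀ * (0ℚ - e zero j) + (simpleRootCombination (λ _ → y₀) j + simpleRootCombination (prefixSum y′) j)
    ≡⟨ cong₂ (λ u v → y₀ * (0ℚ - e zero j) + (u + v)) (simpleRootCombination-const y₀ j) (simpleRootCombination-prefixSum y′ j) ⟩
  y₀ * (0ℚ - e zero j) + (y₀ * (e zero j - eₗ) + (y′ j - eₗ * sumFin y′))
    ≡⟨ solve 5 (λ a x l b s → a :* (con 0ℚ :- x) :+ (a :* (x :- l) :+ (b :- l :* s)) := b :- l :* (a :+ s))
         refl y₀ (e zero j) eₗ (y′ j) (sumFin y′) ⟩
  y′ j - eₗ * (y₀ + sumFin y′)
    ∎
  where
  open ≡-Reasoning
  y₀ = y zero
  y′ = y ∘ suc
  eₗ = e (fromℕ k) j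

rootSign : ∀ {m} → Fin m → Fin m → ℚ
rootSign a b with does (toℕ a ℕ.<? toℕ b)
... | true  = 1ℚ
... | false = - 1ℚ

absRoot≡rootSign*α : ∀ {m} (a b : Fin m) i → absRoot a b i ≡ rootSign a b * α a b i
absRoot≡rootSign*α a b i with does (toℕ a ℕ.<? toℕ b)
... | true  = sym (ℚ.*-identityˡ (α a b i))
... | false = solve 2 (λ x y → y :- x := :- con 1ℚ :* (x :- y)) refl (e a i) (e b i)

rootSign-< : ∀ {m} {a b : Fin m} → a Fin.< b → rootSign a b ≡ 1ℚ
rootSign-< {a = a} {b} a<b rewrite dec-true (toℕ a ℕ.<? toℕ b) a<b = refl

rootSign-> : ∀ {m} {a b : Fin m} → b Fin.< a → rootSign a b ≡ - 1ℚ
rootSign-> {a = a} {b} b<a rewrite dec-false (toℕ a ℕ.<? toℕ b) (ℕₚ.<-asym b<a) = refl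

rootSign²≡1 : ∀ {m} (a b : Fin m) → rootSign a b * rootSign a b ≡ 1ℚ
rootSign²≡1 a b with does (toℕ a ℕ.<? toℕ b)
... | true  = refl
... | false = refl

simpleRootSign : ∀ {k} → Permutation′ (suc k) → Fin k → ℚ
simpleRootSign w i = rootSign (w ⟨$⟩ʳ inject₁ i) (w ⟨$⟩ʳ suc i)

wSimple-combination : ∀ {k} (w : Permutation′ (suc k)) (c : Fin k → ℚ) j →
  sumFin (λ i → c i * wSimple k (w ⟨$⟩ʳ_) i (w ⟨$⟩ʳ j)) ≡ simpleRootCombination (λ i → c i * simpleRootSign w i) j
wSimple-combination w c j = sumFin-cong λ i → begin
  c i * absRoot (w ⟨$⟩ʳ inject₁ i) (w ⟨$⟩ʳ suc i) (w ⟨$⟩ʳ j)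
    ≡⟨ cong (c i *_) (absRoot≡rootSign*α (w ⟨$⟩ʳ inject₁ i) (w ⟨$⟩ʳ suc i) (w ⟨$⟩ʳ j)) ⟩
  c i * (simpleRootSign w i * (e (w ⟨$⟩ʳ inject₁ i) (w ⟨$⟩ʳ j) - e (w ⟨$⟩ʳ suc i) (w ⟨$⟩ʳ j)))
    ≡⟨ cong₂ (λ u v → c i * (simpleRootSign w i * (u - v))) (e-permute w (inject₁ i) j) (e-permute w (suc i) j) ⟩
  c i * (simpleRootSign w i * α (inject₁ i) (suc i) j)
    ≡⟨ ℚ.*-assoc (c i) (simpleRootSign w i) (α (inject₁ i) (suc i) j) ⟨
  c i * simpleRootSign w i * α (inject₁ i) (suc i) j
    ∎
  where open ≡-Reasoning

-- |wαᵢ| = σᵢ wαᵢ and w only permutes coordinates, so x = Σ cᵢ |wαᵢ| iff x∘w = Σ cᵢσᵢ αᵢ.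
module _ {k} (w : Permutation′ (suc k)) (x : Pt (suc k)) where

  private
    y : Pt (suc k)
    y j = x (w ⟨$⟩ʳ j)

  inCone-wSimple⇒signedPrefixSums : InCone (wSimple k (w ⟨$⟩ʳ_)) x →
    ∀ i → 0ℚ ≤ simpleRootSign w i * prefixSum y i
  inCone-wSimple⇒signedPrefixSums (c , 0≤c , x≡) i = subst (0ℚ ≤_) (sym σP≡c) (0≤c i)
    where
    σ = simpleRootSign w i
    P≡cσ : prefixSum y i ≡ c i * σ
    P≡cσ = trans (prefixSum-cong (λ j → trans (x≡ (w ⟨$⟩ʳ j)) (wSimple-combination w c j)) i)
                 (prefixSum-simpleRootCombination (λ l → c l * simpleRootSign w l) i)
    σP≡c : σ * prefixSum y i ≡ c i
    σP≡c = begin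
      σ * prefixSum y i  ≡⟨ cong (σ *_) P≡cσ ⟩
      σ * (c i * σ)      ≡⟨ solve 2 (λ s c → s :* (c :* s) := (s :* s) :* c) refl σ (c i) ⟩
      (σ * σ) * c i      ≡⟨ cong (_* c i) (rootSign²≡1 (w ⟨$⟩ʳ inject₁ i) (w ⟨$⟩ʳ suc i)) ⟩
      1ℚ * c i           ≡⟨ ℚ.*-identityˡ (c i) ⟩
      c i                ∎
      where open ≡-Reasoning

  signedPrefixSums⇒inCone-wSimple : InV x → (∀ i → 0ℚ ≤ simpleRootSign w i * prefixSum y i) →
    InCone (wSimple k (w ⟨$⟩ʳ_)) x
  signedPrefixSums⇒inCone-wSimple x∈V 0≤σP = c , 0≤σP , x≡
    where
    c : Fin k → ℚ
    c i = simpleRootSign w i * prefixSum y i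
    cσ≡P : ∀ i → c i * simpleRootSign w i ≡ prefixSum y i
    cσ≡P i = begin
      σ * prefixSum y i * σ  ≡⟨ solve 2 (λ s p → s :* p :* s := (s :* s) :* p) refl σ (prefixSum y i) ⟩
      (σ * σ) * prefixSum y i ≡⟨ cong (_* prefixSum y i) (rootSign²≡1 (w ⟨$⟩ʳ inject₁ i) (w ⟨$⟩ʳ suc i)) ⟩
      1ℚ * prefixSum y i      ≡⟨ ℚ.*-identityˡ (prefixSum y i) ⟩
      prefixSum y i           ∎
      where
      open ≡-Reasoning
      σ = simpleRootSign w i
    ∑y≡0 : sumFin y ≡ 0ℚ
    ∑y≡0 = trans (sym (sumFin-permute x w)) x∈V
    y≡ : ∀ j → y j ≡ sumFin (λ i → c i * wSimple k (w ⟨$⟩ʳ_) i (w ⟨$⟩ʳ j))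
    y≡ j = begin
      y j                                                       ≡⟨ solve 2 (λ a b → a := a :- b :* con 0ℚ) refl (y j) (e (fromℕ k) j) ⟩
      y j - e (fromℕ k) j * 0ℚ                                  ≡⟨ cong (λ s → y j - e (fromℕ k) j * s) ∑y≡0 ⟨
      y j - e (fromℕ k) j * sumFin y                            ≡⟨ simpleRootCombination-prefixSum y j ⟨
      simpleRootCombination (prefixSum y) j                     ≡⟨ sumFin-cong (λ i → cong (_* α (inject₁ i) (suc i) j) (cσ≡P i)) ⟨
      simpleRootCombination (λ i → c i * simpleRootSign w i) j  ≡⟨ wSimple-combination w c j ⟨
      sumFin (λ i → c i * wSimple k (w ⟨$⟩ʳ_) i (w ⟨$⟩ʳ j))  ∎
      where open ≡-Reasoning
    x≡ : ∀ a → x a ≡ sumFin (λ i → c i * wSimple k (w ⟨$⟩ʳ_) i a)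
    x≡ a = subst (λ b → x b ≡ sumFin (λ i → c i * wSimple k (w ⟨$⟩ʳ_) i b)) (inverseʳ w) (y≡ (w ⟨$⟩ˡ a))

a1-combination-suc : ∀ {k} (c : Fin k → ℚ) j → sumFin (λ l → c l * a1 k l (suc j)) ≡ - c j
a1-combination-suc c j = trans
  (sumFin-cong λ l → solve 2 (λ c x → c :* (con 0ℚ :- x) := (:- c) :* x) refl (c l) (e l j))
  (sumFin-*e (λ l → - c l) j)

inCone-a1⇒nonpositive : ∀ {k} {y : Pt (suc k)} → InCone (a1 k) y → ∀ j → y (suc j) ≤ 0ℚ
inCone-a1⇒nonpositive (c , 0≤c , y≡) j =
  subst (_≤ 0ℚ) (sym (trans (y≡ (suc j)) (a1-combination-suc c j))) (ℚ.neg-antimono-≤ (0≤c j))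

nonpositive⇒inCone-a1 : ∀ {k} {y : Pt (suc k)} → InV y → (∀ j → y (suc j) ≤ 0ℚ) → InCone (a1 k) y
nonpositive⇒inCone-a1 {k} {y} y∈V y≤0 = c , 0≤c , y≡
  where
  c : Fin k → ℚ
  c j = - y (suc j)
  0≤c : ∀ j → 0ℚ ≤ c j
  0≤c j = ℚ.neg-antimono-≤ (y≤0 j)
  S = sumFin (y ∘ suc)
  y≡ : ∀ i → y i ≡ sumFin (λ l → c l * a1 k l i)
  y≡ zero = begin
    y zero                                ≡⟨ solve 2 (λ a s → a := (a :+ s) :- s) refl (y zero) S ⟩
    (y zero + S) - S                      ≡⟨ cong (_- S) y∈V ⟩
    0ℚ - S                                ≡⟨ solve 1 (λ s → con 0ℚ :- s := :- con 1ℚ :* s) refl S ⟩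
    - 1ℚ * S                              ≡⟨ *-distribˡ-sumFin (- 1ℚ) (y ∘ suc) ⟩
    sumFin (λ l → - 1ℚ * y (suc l))       ≡⟨ sumFin-cong (λ l → solve 1 (λ a → :- con 1ℚ :* a := (:- a) :* (con 1ℚ :- con 0ℚ)) refl (y (suc l))) ⟩
    sumFin (λ l → c l * (1ℚ - 0ℚ))        ∎
    where open ≡-Reasoning
  y≡ (suc j) = sym (trans (a1-combination-suc c j) (solve 1 (λ a → :- (:- a) := a) refl (y (suc j))))

interior-a1⇒negative : ∀ {k} {x : Pt (suc k)} → InInterior (InCone (a1 k)) x → ∀ j → x (suc j) < 0ℚ
interior-a1⇒negative {k} {x} (x∈V , ε , 0<ε , ball) j with ℚ.<-dense 0<ε
... | h , 0<h , h<ε = ℚ.<-≤-trans x<x+h (subst (_≤ 0ℚ) y≡x+h (inCone-a1⇒nonpositive y∈a1 j))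
  where
  -- d = h (e_{j+1} − e_0) keeps x + d in V and in the ε-ball, hence in 𝔞¹, forcing x_{j+1} + h ≤ 0.
  d : Pt (suc k)
  d zero    = - h
  d (suc i) = h * e j i
  y : Pt (suc k)
  y i = x i + d i
  ∣h∣≡h : ∣ h ∣ ≡ h
  ∣h∣≡h = ℚ.0≤p⇒∣p∣≡p (ℚ.<⇒≤ 0<h)
  ∣d∣<ε : ∀ i → ∣ d i ∣ < ε
  ∣d∣<ε zero = subst (_< ε) (sym (trans (ℚ.∣-p∣≡∣p∣ h) ∣h∣≡h)) h<ε
  ∣d∣<ε (suc i) with j Fin.≟ i
  ... | yes refl = subst (λ t → ∣ t ∣ < ε) (sym (trans (cong (h *_) (e-diagonal j)) (ℚ.*-identityʳ h)))
                     (subst (_< ε) (sym ∣h∣≡h) h<ε)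
  ... | no j≢i   = subst (λ t → ∣ t ∣ < ε) (sym (trans (cong (h *_) (e-offDiagonal j≢i)) (ℚ.*-zeroʳ h))) 0<ε
  y∈V : InV y
  y∈V = begin
    sumFin y                                ≡⟨ sumFin-+ x d ⟩
    sumFin x + (- h + sumFin (λ i → h * e j i)) ≡⟨ cong₂ (λ s t → s + (- h + t)) x∈V (sym (*-distribˡ-sumFin h (e j))) ⟩
    0ℚ + (- h + h * sumFin (e j))            ≡⟨ cong (λ t → 0ℚ + (- h + h * t)) (sumFin-e j) ⟩
    0ℚ + (- h + h * 1ℚ)                      ≡⟨ solve 1 (λ h → con 0ℚ :+ (:- h :+ h :* con 1ℚ) := con 0ℚ) refl h ⟩
    0ℚ                                       ∎
    where open ≡-Reasoning
  y∈a1 : InCone (a1 k) y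
  y∈a1 = ball y y∈V λ i → subst (λ t → ∣ t ∣ < ε) (solve 2 (λ a b → b := (a :+ b) :- a) refl (x i) (d i)) (∣d∣<ε i)
  y≡x+h : y (suc j) ≡ x (suc j) + h
  y≡x+h = trans (cong (λ t → x (suc j) + h * t) (e-diagonal j)) (cong (x (suc j) +_) (ℚ.*-identityʳ h))
  x<x+h : x (suc j) < x (suc j) + h
  x<x+h = subst (_< x (suc j) + h) (ℚ.+-identityʳ (x (suc j))) (ℚ.+-monoʳ-< (x (suc j)) 0<h)

p≤∣p∣ : ∀ p → p ≤ ∣ p ∣
p≤∣p∣ p with ℚ.≤-total 0ℚ p
... | inj₁ 0≤p = ℚ.≤-reflexive (sym (ℚ.0≤p⇒∣p∣≡p 0≤p))
... | inj₂ p≤0 = ℚ.≤-trans p≤0 (ℚ.0≤∣p∣ p)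

a1-interior-point : ∀ k → Σ (Pt (suc k)) (InInterior (InCone (a1 k)))
a1-interior-point k = x₀ , ℚ.+-inverseˡ (sumFin {k} (λ _ → - 1ℚ)) , 1ℚ , ℚ.positive⁻¹ 1ℚ , ball
  where
  x₀ : Pt (suc k)
  x₀ zero    = - sumFin {k} (λ _ → - 1ℚ)
  x₀ (suc j) = - 1ℚ
  ball : ∀ y → InV y → (∀ i → ∣ y i - x₀ i ∣ < 1ℚ) → InCone (a1 k) y
  ball y y∈V close = nonpositive⇒inCone-a1 y∈V λ j → ℚ.<⇒≤ (subst₂ _<_
    (solve 1 (λ a → (a :- :- con 1ℚ) :+ :- con 1ℚ := a) refl (y (suc j)))
    (ℚ.+-inverseʳ 1ℚ)
    (ℚ.+-monoˡ-< (- 1ℚ) (ℚ.≤-<-trans (p≤∣p∣ (y (suc j) - - 1ℚ)) (close (suc j)))))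

Ascent : ∀ {k n} → (Fin (suc k) → Fin n) → Fin k → Set
Ascent f i = f (inject₁ i) Fin.< f (suc i)

Descent : ∀ {k n} → (Fin (suc k) → Fin n) → Fin k → Set
Descent f i = f (suc i) Fin.< f (inject₁ i)

ValleyShaped : ∀ {k n} → (Fin (suc k) → Fin n) → Set
ValleyShaped f = ∀ i j → i Fin.≤ j → Ascent f i → ¬ Descent f j

inject₁<suc : ∀ {k} (i : Fin k) → inject₁ i Fin.< suc i
inject₁<suc i = s≤s (ℕₚ.≤-reflexive (toℕ-inject₁ i))

ascent-or-descent : ∀ {k} (w : Permutation′ (suc k)) i → Ascent (w ⟨$⟩ʳ_) i ⊎ Descent (w ⟨$⟩ʳ_) i
ascent-or-descent w i with Finₚ.<-cmp (w ⟨$⟩ʳ inject₁ i) (w ⟨$⟩ʳ suc i)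
... | tri< asc _ _  = inj₁ asc
... | tri≈ _ eq _   = ⊥-elim (Finₚ.<⇒≢ (inject₁<suc i) (permutation-injective w eq))
... | tri> _ _ desc = inj₂ desc

nonzero-off-preimage : ∀ {k} (w : Permutation′ (suc k)) {p} → w ⟨$⟩ʳ p ≡ zero → ∀ a → a ≢ p → zero {k} Fin.< w ⟨$⟩ʳ a
nonzero-off-preimage w wp≡0 a a≢p with w ⟨$⟩ʳ a in wa
... | zero  = ⊥-elim (a≢p (permutation-injective w (trans wa (sym wp≡0))))
... | suc _ = s≤s z≤n

module _ {k} (w : Permutation′ (suc k)) (valley : ValleyShaped (w ⟨$⟩ʳ_)) where

  descent-before-minimum : ∀ {p} → w ⟨$⟩ʳ p ≡ zero → ∀ i → i Fin.< p → Descent (w ⟨$⟩ʳ_) i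
  descent-before-minimum {suc q} wq≡0 i i<p with ascent-or-descent w i
  ... | inj₂ desc = desc
  ... | inj₁ asc  = ⊥-elim (valley i q (ℕₚ.≤-pred i<p) asc descent-at-q)
    where
    descent-at-q : Descent (w ⟨$⟩ʳ_) q
    descent-at-q = subst (Fin._< w ⟨$⟩ʳ inject₁ q) (sym wq≡0)
                     (nonzero-off-preimage w wq≡0 (inject₁ q) (Finₚ.<⇒≢ (inject₁<suc q)))

  ascent-from-minimum : ∀ {p} → w ⟨$⟩ʳ p ≡ zero → ∀ i → p Fin.≤ i → Ascent (w ⟨$⟩ʳ_) i
  ascent-from-minimum {p} wp≡0 i p≤i with view p
  ... | ‵fromℕ = ⊥-elim (ℕₚ.<-irrefl refl
                   (ℕₚ.≤-<-trans (subst (ℕ._≤ toℕ i) (toℕ-fromℕ k) p≤i) (Finₚ.toℕ<n i)))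
  ... | ‵inject₁ q with ascent-or-descent w i
  ...   | inj₁ asc  = asc
  ...   | inj₂ desc = ⊥-elim (valley q i (subst (ℕ._≤ toℕ i) (toℕ-inject₁ q) p≤i) ascent-at-q desc)
    where
    ascent-at-q : Ascent (w ⟨$⟩ʳ_) q
    ascent-at-q = subst (Fin._< w ⟨$⟩ʳ suc q) (sym wp≡0)
                    (nonzero-off-preimage w wp≡0 (suc q) (≢-sym (Finₚ.<⇒≢ (inject₁<suc q))))

simpleRootSign-ascent : ∀ {k} (w : Permutation′ (suc k)) {i} → Ascent (w ⟨$⟩ʳ_) i → ∀ q → simpleRootSign w i * q ≡ q
simpleRootSign-ascent w asc q = trans (cong (_* q) (rootSign-< asc)) (ℚ.*-identityˡ q)

simpleRootSign-descent : ∀ {k} (w : Permutation′ (suc k)) {i} → Descent (w ⟨$⟩ʳ_) i → ∀ q → simpleRootSign w i * q ≡ - q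
simpleRootSign-descent w desc q = trans (cong (_* q) (rootSign-> desc)) (solve 1 (λ q → :- con 1ℚ :* q := :- q) refl q)

module _ {k} (w : Permutation′ (suc k)) {x : Pt (suc k)} (x-int : InInterior (InCone (a1 k)) x) where

  private
    ∑x∘w≡0 : sumFin (λ l → x (w ⟨$⟩ʳ l)) ≡ 0ℚ
    ∑x∘w≡0 = trans (sym (sumFin-permute x w)) (proj₁ x-int)

    x∘w<0 : ∀ l → l ≢ w ⟨$⟩ˡ zero → x (w ⟨$⟩ʳ l) < 0ℚ
    x∘w<0 l l≢p with w ⟨$⟩ʳ l in wl
    ... | zero  = ⊥-elim (l≢p (trans (sym (inverseˡ w)) (cong (w ⟨$⟩ˡ_) wl)))
    ... | suc j = interior-a1⇒negative x-int j

  interior-prefixSum-negative-before : ∀ i → i Fin.< w ⟨$⟩ˡ zero → prefixSum (λ l → x (w ⟨$⟩ʳ l)) i < 0ℚ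
  interior-prefixSum-negative-before = prefixSum-negative-before ∑x∘w≡0 x∘w<0

  interior-prefixSum-positive-from : ∀ i → w ⟨$⟩ˡ zero Fin.≤ i → 0ℚ < prefixSum (λ l → x (w ⟨$⟩ʳ l)) i
  interior-prefixSum-positive-from = prefixSum-positive-from ∑x∘w≡0 x∘w<0

W1⇒ValleyShaped : ∀ {k} (w : Permutation′ (suc k)) → W1 k w → ValleyShaped (w ⟨$⟩ʳ_)
W1⇒ValleyShaped {k} w w∈W1 i j i≤j asc desc = ℕₚ.<-irrefl refl (ℕₚ.≤-<-trans p≤i (ℕₚ.≤-<-trans i≤j j<p))
  where
  x = proj₁ (a1-interior-point k)
  x-int = proj₂ (a1-interior-point k)
  p = w ⟨$⟩ˡ zero
  y : Pt (suc k)
  y l = x (w ⟨$⟩ʳ l)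
  0≤σP : ∀ i → 0ℚ ≤ simpleRootSign w i * prefixSum y i
  0≤σP = inCone-wSimple⇒signedPrefixSums w x (w∈W1 x x-int)
  p≤i : p Fin.≤ i
  p≤i = ℕₚ.≮⇒≥ λ i<p → ℚ.<-irrefl refl (ℚ.≤-<-trans
    (subst (0ℚ ≤_) (simpleRootSign-ascent w asc (prefixSum y i)) (0≤σP i))
    (interior-prefixSum-negative-before w x-int i i<p))
  j<p : j Fin.< p
  j<p = ℕₚ.≰⇒> λ p≤j → ℚ.<-irrefl refl (ℚ.<-≤-trans
    (interior-prefixSum-positive-from w x-int j p≤j)
    (subst (_≤ 0ℚ) (solve 1 (λ q → :- (:- q) := q) refl (prefixSum y j))
      (ℚ.neg-antimono-≤ (subst (0ℚ ≤_) (simpleRootSign-descent w desc (prefixSum y j)) (0≤σP j)))))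

ValleyShaped⇒W1 : ∀ {k} (w : Permutation′ (suc k)) → ValleyShaped (w ⟨$⟩ʳ_) → W1 k w
ValleyShaped⇒W1 {k} w valley x x-int = signedPrefixSums⇒inCone-wSimple w x (proj₁ x-int) 0≤σP
  where
  p = w ⟨$⟩ˡ zero
  y : Pt (suc k)
  y l = x (w ⟨$⟩ʳ l)
  0≤σP : ∀ i → 0ℚ ≤ simpleRootSign w i * prefixSum y i
  0≤σP i with toℕ i ℕ.<? toℕ p
  ... | yes i<p = subst (0ℚ ≤_) (sym (simpleRootSign-descent w (descent-before-minimum w valley (inverseʳ w) i i<p) (prefixSum y i)))
    (ℚ.neg-antimono-≤ (ℚ.<⇒≤ (interior-prefixSum-negative-before w x-int i i<p)))
  ... | no i≮p = subst (0ℚ ≤_) (sym (simpleRootSign-ascent w (ascent-from-minimum w valley (inverseʳ w) i p≤i) (prefixSum y i)))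
    (ℚ.<⇒≤ (interior-prefixSum-positive-from w x-int i p≤i))
    where
    p≤i : p Fin.≤ i
    p≤i = ℕₚ.≮⇒≥ i≮p

ValleyShaped-cong : ∀ {k n} {f g : Fin (suc k) → Fin n} → (∀ i → f i ≡ g i) → ValleyShaped f → ValleyShaped g
ValleyShaped-cong {f = f} {g} f≗g valley i j i≤j asc desc = valley i j i≤j
  (subst₂ Fin._<_ (sym (f≗g (inject₁ i))) (sym (f≗g (suc i))) asc)
  (subst₂ Fin._<_ (sym (f≗g (suc j))) (sym (f≗g (inject₁ j))) desc)

lowerLast-inject₁ : ∀ m (j : Fin m) → lowerLast m (inject₁ j) ≡ just j
lowerLast-inject₁ (suc m) zero    = refl
lowerLast-inject₁ (suc m) (suc j) = cong (Maybe.map suc) (lowerLast-inject₁ m j)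

lowerLast-fromℕ : ∀ m → lowerLast m (fromℕ m) ≡ nothing
lowerLast-fromℕ ℕ.zero = refl
lowerLast-fromℕ (suc m) = cong (Maybe.map suc) (lowerLast-fromℕ m)

ext-inject₁ : ∀ {m} (u : Permutation′ m) j → ext u (inject₁ j) ≡ inject₁ (u ⟨$⟩ʳ j)
ext-inject₁ {m} u j rewrite lowerLast-inject₁ m j = refl

ext-fromℕ : ∀ {m} (u : Permutation′ m) → ext u (fromℕ m) ≡ fromℕ m
ext-fromℕ {m} u rewrite lowerLast-fromℕ m = refl

toℕ-ext-inject₁ : ∀ {m} (u : Permutation′ m) j → toℕ (ext u (inject₁ j)) ≡ toℕ (u ⟨$⟩ʳ j)
toℕ-ext-inject₁ u j = trans (cong toℕ (ext-inject₁ u j)) (toℕ-inject₁ (u ⟨$⟩ʳ j))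

module _ {k} (u : Permutation′ (suc k)) where

  private
    ext-<⇒< : ∀ {a b} → ext u (inject₁ a) Fin.< ext u (inject₁ b) → u ⟨$⟩ʳ a Fin.< u ⟨$⟩ʳ b
    ext-<⇒< {a} {b} = subst₂ ℕ._<_ (toℕ-ext-inject₁ u a) (toℕ-ext-inject₁ u b)

    <⇒ext-< : ∀ {a b} → u ⟨$⟩ʳ a Fin.< u ⟨$⟩ʳ b → ext u (inject₁ a) Fin.< ext u (inject₁ b)
    <⇒ext-< {a} {b} = subst₂ ℕ._<_ (sym (toℕ-ext-inject₁ u a)) (sym (toℕ-ext-inject₁ u b))

    inject₁-≤ : ∀ {n} {i j : Fin n} → i Fin.≤ j → inject₁ i Fin.≤ inject₁ j
    inject₁-≤ {i = i} {j} = subst₂ ℕ._≤_ (sym (toℕ-inject₁ i)) (sym (toℕ-inject₁ j))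

  ValleyShaped-ext⁻¹ : ValleyShaped (ext u) → ValleyShaped (u ⟨$⟩ʳ_)
  ValleyShaped-ext⁻¹ valley i j i≤j asc desc = valley (inject₁ i) (inject₁ j) (inject₁-≤ i≤j) (<⇒ext-< asc) (<⇒ext-< desc)

  ValleyShaped-ext : ValleyShaped (u ⟨$⟩ʳ_) → ValleyShaped (ext u)
  ValleyShaped-ext valley i j i≤j asc desc with view j
  ... | ‵fromℕ = ℕₚ.<⇒≱ desc (subst (λ t → ext u (inject₁ (fromℕ k)) Fin.≤ t) (sym (ext-fromℕ u)) (Finₚ.≤fromℕ _))
  ... | ‵inject₁ j′ with view i
  ...   | ‵fromℕ = ℕₚ.<⇒≱ (subst (ℕ._< k) (sym (toℕ-inject₁ j′)) (Finₚ.toℕ<n j′))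
                     (subst₂ ℕ._≤_ (toℕ-fromℕ k) refl i≤j)
  ...   | ‵inject₁ i′ = valley i′ j′ (subst₂ ℕ._≤_ (toℕ-inject₁ i′) (toℕ-inject₁ j′) i≤j) (ext-<⇒< asc) (ext-<⇒< desc)

opposite-inject₁ : ∀ {n} (i : Fin n) → opposite (inject₁ i) ≡ suc (opposite i)
opposite-inject₁ {suc n} zero    = refl
opposite-inject₁ {suc n} (suc i) = cong inject₁ (opposite-inject₁ i)

opposite-fromℕ : ∀ n → opposite (fromℕ n) ≡ zero
opposite-fromℕ ℕ.zero  = refl
opposite-fromℕ (suc n) = cong inject₁ (opposite-fromℕ n)

opposite-antimono : ∀ {n} {i j : Fin n} → i Fin.≤ j → opposite j Fin.≤ opposite i
opposite-antimono {n} {i} {j} i≤j =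
  subst₂ ℕ._≤_ (sym (opposite-prop j)) (sym (opposite-prop i)) (ℕₚ.∸-monoʳ-≤ n (s≤s i≤j))

ValleyShaped-opposite : ∀ {k n} {f : Fin (suc k) → Fin n} → ValleyShaped f → ValleyShaped (f ∘ opposite)
ValleyShaped-opposite {f = f} valley i j i≤j asc desc = valley (opposite j) (opposite i) (opposite-antimono i≤j)
  (subst (λ b → f (inject₁ (opposite j)) Fin.< f b) (opposite-inject₁ j) desc)
  (subst (λ a → f a Fin.< f (inject₁ (opposite i))) (opposite-inject₁ i) asc)

below-fromℕ-off-preimage : ∀ {k} (w : Permutation′ (suc k)) {q} → w ⟨$⟩ʳ q ≡ fromℕ k →
  ∀ a → a ≢ q → w ⟨$⟩ʳ a Fin.< fromℕ k
below-fromℕ-off-preimage w wq≡max a a≢q = ℕₚ.≤∧≢⇒< (Finₚ.≤fromℕ (w ⟨$⟩ʳ a))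
  (λ eq → a≢q (permutation-injective w (trans (toℕ-injective eq) (sym wq≡max))))

maximum-at-end : ∀ {k} (w : Permutation′ (suc k)) → ValleyShaped (w ⟨$⟩ʳ_) →
  w ⟨$⟩ʳ zero ≡ fromℕ k ⊎ w ⟨$⟩ʳ fromℕ k ≡ fromℕ k
maximum-at-end {k} w valley = at (w ⟨$⟩ˡ fromℕ k) (inverseʳ w)
  where
  at : ∀ q → w ⟨$⟩ʳ q ≡ fromℕ k → w ⟨$⟩ʳ zero ≡ fromℕ k ⊎ w ⟨$⟩ʳ fromℕ k ≡ fromℕ k
  at zero    wq≡max = inj₁ wq≡max
  at (suc a) wq≡max with view a
  ... | ‵fromℕ     = inj₂ wq≡max
  ... | ‵inject₁ b = ⊥-elim (valley (inject₁ b) (suc b) (ℕₚ.<⇒≤ (inject₁<suc b))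
    (subst (w ⟨$⟩ʳ inject₁ (inject₁ b) Fin.<_) (sym wq≡max)
      (below-fromℕ-off-preimage w wq≡max _ (Finₚ.<⇒≢ (inject₁<suc (inject₁ b)))))
    (subst (w ⟨$⟩ʳ suc (suc b) Fin.<_) (sym wq≡max)
      (below-fromℕ-off-preimage w wq≡max _ (≢-sym (Finₚ.<⇒≢ (s≤s (inject₁<suc b)))))))

punchIn-fromℕ : ∀ {n} (j : Fin n) → punchIn (fromℕ n) j ≡ inject₁ j
punchIn-fromℕ zero    = refl
punchIn-fromℕ (suc j) = cong suc (punchIn-fromℕ j)

fixes-fromℕ⇒≗ext-remove : ∀ {m} (w : Permutation′ (suc m)) → w ⟨$⟩ʳ fromℕ m ≡ fromℕ m →
  ∀ i → w ⟨$⟩ʳ i ≡ ext (remove (fromℕ m) w) i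
fixes-fromℕ⇒≗ext-remove {m} w w-fixes i with view i
... | ‵fromℕ     = trans w-fixes (sym (ext-fromℕ (remove (fromℕ m) w)))
... | ‵inject₁ j = begin
  w ⟨$⟩ʳ inject₁ j                                 ≡⟨ cong (w ⟨$⟩ʳ_) (punchIn-fromℕ j) ⟨
  w ⟨$⟩ʳ punchIn (fromℕ m) j                       ≡⟨ punchIn-permute w (fromℕ m) j ⟩
  punchIn (w ⟨$⟩ʳ fromℕ m) (u ⟨$⟩ʳ j)              ≡⟨ cong (λ a → punchIn a (u ⟨$⟩ʳ j)) w-fixes ⟩
  punchIn (fromℕ m) (u ⟨$⟩ʳ j)                     ≡⟨ punchIn-fromℕ (u ⟨$⟩ʳ j) ⟩
  inject₁ (u ⟨$⟩ʳ j)                               ≡⟨ ext-inject₁ u j ⟨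
  ext u (inject₁ j)                                ∎
  where
  open ≡-Reasoning
  u = remove (fromℕ m) w

W1-ext : ∀ {k} (w : Permutation′ (suc (suc k))) (u : Permutation′ (suc k)) →
  (∀ i → w ⟨$⟩ʳ i ≡ ext u i) → W1 (suc k) w ⇔ W1 k u
W1-ext w u w≗ext = mk⇔
  (ValleyShaped⇒W1 u ∘ ValleyShaped-ext⁻¹ u ∘ ValleyShaped-cong w≗ext ∘ W1⇒ValleyShaped w)
  (ValleyShaped⇒W1 w ∘ ValleyShaped-cong (sym ∘ w≗ext) ∘ ValleyShaped-ext u ∘ W1⇒ValleyShaped u)

W1-reverse : ∀ {k} (w : Permutation′ (suc k)) → W1 k w ⇔ W1 k (reverse ∘ₚ w)
W1-reverse w = mk⇔
  (ValleyShaped⇒W1 (reverse ∘ₚ w) ∘ ValleyShaped-opposite {f = w ⟨$⟩ʳ_} ∘ W1⇒ValleyShaped w)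
  (ValleyShaped⇒W1 w ∘ ValleyShaped-cong {f = (reverse ∘ₚ w ⟨$⟩ʳ_) ∘ opposite} (cong (w ⟨$⟩ʳ_) ∘ opposite-involutive)
    ∘ ValleyShaped-opposite {f = reverse ∘ₚ w ⟨$⟩ʳ_}
    ∘ W1⇒ValleyShaped (reverse ∘ₚ w))


W1-restrict : ∀ {k} (w : Permutation′ (suc (suc k))) → W1 (suc k) w → w ⟨$⟩ʳ fromℕ (suc k) ≡ fromℕ (suc k) →
  Σ (Permutation′ (suc k)) λ u → W1 k u × (∀ i → w ⟨$⟩ʳ i ≡ ext u i)
W1-restrict w w∈W1 w-fixes = u , Equivalence.to (W1-ext w u w≗ext) w∈W1 , w≗ext
  where
  u = remove (fromℕ _) w
  w≗ext = fixes-fromℕ⇒≗ext-remove w w-fixes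

module _ {n} (w : Permutation′ n) (g : Fin n → Fin n) where

  reverse-≗⇒≗∘opposite : (∀ i → (reverse ∘ₚ w) ⟨$⟩ʳ i ≡ g i) → ∀ i → w ⟨$⟩ʳ i ≡ g (opposite i)
  reverse-≗⇒≗∘opposite v≗g i = trans (cong (w ⟨$⟩ʳ_) (sym (opposite-involutive i))) (v≗g (opposite i))

  ≗∘opposite⇒reverse-≗ : (∀ i → w ⟨$⟩ʳ i ≡ g (opposite i)) → ∀ i → (reverse ∘ₚ w) ⟨$⟩ʳ i ≡ g i
  ≗∘opposite⇒reverse-≗ w≗g∘opp i = trans (w≗g∘opp (opposite i)) (cong g (opposite-involutive i))

lemma3p2 : ∀ (m : ℕ) (w : Permutation′ (suc (suc (suc m)))) →
    W1 (suc (suc m)) w ⇔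
      ((Σ (Permutation′ (suc (suc m))) λ u →
          W1 (suc m) u × (∀ i → w ⟨$⟩ʳ i ≡ ext u i))
       ⊎
       (Σ (Permutation′ (suc (suc m))) λ u →
          W1 (suc m) u × (∀ i → w ⟨$⟩ʳ i ≡ ext u (w₀ i))))
lemma3p2 m w = mk⇔
  (λ w∈W1 → case maximum-at-end w (W1⇒ValleyShaped w w∈W1) of λ where
    (inj₂ w-fixes)  → inj₁ (W1-restrict w w∈W1 w-fixes)
    (inj₁ w₀-fixes) → inj₂ (map₂ (λ {u} → map₂ (reverse-≗⇒≗∘opposite w (ext u)))
      (W1-restrict v (Equivalence.to (W1-reverse w) w∈W1) (trans (cong (w ⟨$⟩ʳ_) (opposite-fromℕ _)) w₀-fixes))))
  λ where
    (inj₁ (u , u∈W1 , w≗ext))     → Equivalence.from (W1-ext w u w≗ext) u∈W1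
    (inj₂ (u , u∈W1 , w≗ext∘w₀)) →
      Equivalence.from (W1-reverse w) (Equivalence.from (W1-ext v u (≗∘opposite⇒reverse-≗ w (ext u) w≗ext∘w₀)) u∈W1)
  where
  v = reverse ∘ₚ w
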